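{- Let $k\ge1$, $n\ge1$, and let $e_1,\ldots,e_{k^{n+1}}$ be a pointed Eulerian cycle in the de Bruijn graph $G(k,n)$, with $v_i$ the head of $e_i$. For $0\le j<k^n$ let section $j$ be the sequence $v_{jk+1},\ldots,v_{jk+k}$ of $k$ consecutive head vertices. Let $D(k,n)$ be the bipartite (multi)graph whose two vertex classes are the vertex set of $G(k,n)$ and the set of sections $\{0,\ldots,k^n-1\}$, with an edge $(v,j)$ for each occurrence of the vertex $v$ in section $j$. Then $D(k,n)$ has a perfect matching; that is, there is a bijection $\phi$ from the vertices of $G(k,n)$ to the sections such that each vertex $v$ occurs in section $\phi(v)$.
   Context: The de Bruijn graph $G(k,n)$ is the directed graph whose vertices are the words of length $n$ over a fixed $k$-symbol alphabet, with an edge from $v$ to $w$ whenever $v=au$, $w=ub$ for some word $u$ of length $n-1$ and symbols $a,b$; it has $k^n$ vertices and $k^{n+1}$ edges. A pointed cycle is a cycle with a specified starting edge; an Eulerian cycle traverses every edge exactly once, so every vertex occurs exactly $k$ times among the heads $v_1,\ldots,v_{k^{n+1}}$. A perfect matching is a set of edges, no two sharing an endpoint, covering all vertices. -}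

module Defs where

open import Data.Nat using (ℕ; zero; suc; _+_; _*_; _^_)
open import Data.Fin using (Fin; toℕ)
open import Data.Vec using (Vec; _∷_; []; init; tail)
open import Data.Product using (Σ; ∃; _×_; _,_)
open import Data.Sum using (_⊎_)
open import Function.Definitions using (Bijective)
open import Relation.Binary.PropositionalEquality using (_≡_)

Vertex : ℕ → ℕ → Set
Vertex k n = Vec (Fin k) n

-- Edges of G(k,n): words of length n+1.  The word  a u b  (|u| = n-1) is the
-- edge from  a u  (its first n letters) to  u b  (its last n letters).
-- This is a bijection with the edge set {(au, ub)} (k^(n+1) edges).
Edge : ℕ → ℕ → Set
Edge k n = Vec (Fin k) (suc n)

source : ∀ {k n} → Edge k n → Vertex k n
source = init

head : ∀ {k n} → Edge k n → Vertex k n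
head = tail

numEdges : ℕ → ℕ → ℕ
numEdges k n = k ^ suc n

CyclicSucc : ∀ {m} → Fin m → Fin m → Set
CyclicSucc {m} i j = (toℕ j ≡ suc (toℕ i)) ⊎ ((suc (toℕ i) ≡ m) × (toℕ j ≡ 0))

IsPointedCycle : ∀ {k n m} → (Fin m → Edge k n) → Set
IsPointedCycle {k} {n} {m} e =
  ∀ (i j : Fin m) → CyclicSucc i j → head (e i) ≡ source (e j)

IsPointedEulerian : ∀ k n → (Fin (numEdges k n) → Edge k n) → Set
IsPointedEulerian k n e = IsPointedCycle e × Bijective _≡_ _≡_ e

-- Vertex v occurs in section j: some v_{jk+r+1} (1-indexed), r < k, equals v,
-- i.e. head of the edge at 0-indexed position jk + r is v.
OccursIn : ∀ {k n} → (Fin (numEdges k n) → Edge k n) → Vertex k n → Fin (k ^ n) → Set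
OccursIn {k} {n} e v j =
  Σ (Fin k) λ r → Σ (Fin (numEdges k n)) λ i →
    (toℕ i ≡ toℕ j * k + toℕ r) × (head (e i) ≡ v)

HasPerfectMatchingD : ∀ k n → (Fin (numEdges k n) → Edge k n) → Set
HasPerfectMatchingD k n e =
  Σ (Vertex k n → Fin (k ^ n)) λ φ → Bijective _≡_ _≡_ φ × (∀ v → OccursIn e v (φ v))

module Submission where

-- The graph D(k,n) is k-regular: section j contains the k head vertices at cycle
-- positions jk, …, jk + k - 1, and a vertex v is the head of exactly the k edges
-- a v' (a a letter), each of which occurs once in the cycle.  Only these counts
-- matter, and the
-- theorem is the classical fact that a k-regular bipartite multigraph (k ≥ 1)
-- has a perfect matching, proved constructively by augmenting paths.
--
-- Alternating
--     reachability from an unmatched node stabilises; the reached set has a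
--     slot at a free vertex (Hall's counting argument, phrased as an injective
--     endomap of the slots that is not onto), and the alternating path to it
--     augments the matching.  Iterating matches every node.
--   * Sections: the de Bruijn instance, where a slot is a position of the
--     cycle and its colour is the first letter of the edge at that position.

open import Defs
open import Data.Bool using (true; false)
open import Data.Empty using (⊥; ⊥-elim)
open import Data.Fin using (Fin; zero; suc; toℕ; cast; combine; remQuot; fromℕ<; funToFin; finToFun; punchOut)
open import Data.Fin.Properties using (_≟_; any?; toℕ-cast; toℕ-combine; toℕ-injective; combine-injective; combine-remQuot; remQuot-combine; punchOut-injective; injective⇒≤; finToFun-funToFin)
open import Data.List using (List; []; _∷_; allFin)
open import Data.List.Relation.Unary.All as All using (All; []; _∷_)
open import Data.List.Membership.Propositional.Properties using (∈-allFin)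
open import Data.Maybe using (Maybe; just; nothing)
open import Data.Maybe.Properties using (just-injective)
open import Data.Nat using (ℕ; zero; suc; _+_; _*_; _^_; _≤_; _<_; _≥_; z≤n; s≤s)
open import Data.Nat.Properties using (≤-trans; <⇒≱; m≤n⇒m≤1+n; 1+n≰n; *-comm)
open import Data.Product using (Σ; ∃; ∃₂; _×_; _,_; proj₁; proj₂; uncurry)
open import Data.Sum using (_⊎_; inj₁; inj₂)
open import Data.Vec using (Vec; _∷_; lookup; tabulate)
open import Data.Vec as Vec using ()
open import Data.Vec.Properties using (≡-dec; tabulate∘lookup; tabulate-cong)
open import Data.Vec.Functional using (updateAt)
open import Data.Vec.Functional.Properties using (updateAt-updates; updateAt-minimal)
open import Function using (_∘_; id; const)
open import Function.Definitions using (Injective; Bijective)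
open import Level using (0ℓ)
open import Relation.Binary.Definitions using (DecidableEquality)
open import Relation.Binary.PropositionalEquality using (_≡_; _≢_; refl; sym; trans; cong; cong₂; subst; module ≡-Reasoning)
open import Relation.Nullary using (¬_; Dec; yes; no; does)
open import Relation.Nullary.Decidable using (¬?; _×-dec_; _⊎-dec_; decidable-stable)
open import Relation.Unary using (Pred; Decidable; _⊆_)

count : ∀ {N} {P : Pred (Fin N) 0ℓ} → Decidable P → ℕ
count {zero} P? = 0
count {suc N} P? with does (P? zero)
... | true = suc (count (P? ∘ suc))
... | false = count (P? ∘ suc)

count-≤ : ∀ {N} {P : Pred (Fin N) 0ℓ} (P? : Decidable P) → count P? ≤ N
count-≤ {zero} P? = z≤n
count-≤ {suc N} P? with does (P? zero)
... | true = s≤s (count-≤ (P? ∘ suc))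
... | false = m≤n⇒m≤1+n (count-≤ (P? ∘ suc))

count-mono : ∀ {N} {P Q : Pred (Fin N) 0ℓ} (P? : Decidable P) (Q? : Decidable Q) →
  P ⊆ Q → count P? ≤ count Q?
count-mono {zero} P? Q? P⊆Q = z≤n
count-mono {suc N} P? Q? P⊆Q with P? zero | Q? zero
... | yes _ | yes _ = s≤s (count-mono (P? ∘ suc) (Q? ∘ suc) P⊆Q)
... | yes p | no ¬q = ⊥-elim (¬q (P⊆Q p))
... | no _  | yes _ = m≤n⇒m≤1+n (count-mono (P? ∘ suc) (Q? ∘ suc) P⊆Q)
... | no _  | no _  = count-mono (P? ∘ suc) (Q? ∘ suc) P⊆Q

count-< : ∀ {N} {P Q : Pred (Fin N) 0ℓ} (P? : Decidable P) (Q? : Decidable Q) →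
  P ⊆ Q → ∀ {x} → Q x → ¬ P x → count P? < count Q?
count-< P? Q? P⊆Q {zero} q ¬p with P? zero | Q? zero
... | yes p | _     = ⊥-elim (¬p p)
... | no _  | yes _ = s≤s (count-mono (P? ∘ suc) (Q? ∘ suc) P⊆Q)
... | no _  | no ¬q = ⊥-elim (¬q q)
count-< P? Q? P⊆Q {suc x} q ¬p with P? zero | Q? zero
... | yes _ | yes _ = s≤s (count-< (P? ∘ suc) (Q? ∘ suc) P⊆Q q ¬p)
... | yes p | no ¬q = ⊥-elim (¬q (P⊆Q p))
... | no _  | yes _ = m≤n⇒m≤1+n (count-< (P? ∘ suc) (Q? ∘ suc) P⊆Q q ¬p)
... | no _  | no _  = count-< (P? ∘ suc) (Q? ∘ suc) P⊆Q q ¬p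

-- An increasing chain P 0 ⊆ P 1 ⊆ … of decidable subsets of Fin N becomes
-- stationary: every proper step adds an element, which can happen ≤ N times.
module _ {N} {P : ℕ → Pred (Fin N) 0ℓ} (P? : ∀ t → Decidable (P t))
         (grows : ∀ t → P t ⊆ P (suc t)) where

  Stationary : ℕ → Set
  Stationary t = P (suc t) ⊆ P t

  stationary-or-large : ∀ t → ∃ Stationary ⊎ t ≤ count (P? t)
  stationary-or-large zero = inj₂ z≤n
  stationary-or-large (suc t) with stationary-or-large t
  ... | inj₁ stat = inj₁ stat
  ... | inj₂ t≤ with any? (λ x → P? (suc t) x ×-dec ¬? (P? t x))
  ...   | yes (x , new , ¬old) = inj₂ (≤-trans (s≤s t≤) (count-< (P? t) (P? (suc t)) (grows t) new ¬old))
  ...   | no none = inj₁ (t , λ {x} new → decidable-stable (P? t x) (λ ¬old → none (x , new , ¬old)))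

  stabilises : ∃ Stationary
  stabilises with stationary-or-large (suc N)
  ... | inj₁ stat = stat
  ... | inj₂ large = ⊥-elim (<⇒≱ large (count-≤ (P? (suc N))))

-- An injective endomap of Fin M is onto: if y were missed, punching y out of
-- the codomain would give an injection Fin M → Fin (M - 1).
injective⇒surjective : ∀ {M} {f : Fin M → Fin M} → Injective _≡_ _≡_ f → ∀ y → ∃ λ x → f x ≡ y
injective⇒surjective {suc M} {f} f-injective y with any? (λ x → f x ≟ y)
... | yes hit = hit
... | no miss = ⊥-elim (1+n≰n (injective⇒≤ punched-injective))
  where
  punched : Fin (suc M) → Fin M
  punched x = punchOut {i = y} {j = f x} (λ y≡fx → miss (x , sym y≡fx))
  punched-injective : Injective _≡_ _≡_ punched
  punched-injective = f-injective ∘ punchOut-injective {i = y} _ _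

injective⇒surjective² : ∀ {N k} {f : Fin N × Fin k → Fin N × Fin k} →
  Injective _≡_ _≡_ f → ∀ y → ∃ λ x → f x ≡ y
injective⇒surjective² {N} {k} {f} f-injective y = split p , (begin
    f (split p)          ≡⟨ sym (split∘join (f (split p))) ⟩
    split (join (f (split p)))  ≡⟨ cong split flat-p≡join-y ⟩
    split (join y)       ≡⟨ split∘join y ⟩
    y                    ∎)
  where
  open ≡-Reasoning
  split : Fin (N * k) → Fin N × Fin k
  split = remQuot {N} k
  join : Fin N × Fin k → Fin (N * k)
  join = uncurry combine
  split∘join : ∀ x → split (join x) ≡ x
  split∘join (i , j) = remQuot-combine i j
  flat : Fin (N * k) → Fin (N * k)
  flat = join ∘ f ∘ split
  flat-injective : Injective _≡_ _≡_ flat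
  flat-injective {p} {q} flat-p≡flat-q = begin
    p                ≡⟨ sym (combine-remQuot {N} k p) ⟩
    join (split p)   ≡⟨ cong join (f-injective f-equal) ⟩
    join (split q)   ≡⟨ combine-remQuot {N} k q ⟩
    q                ∎
    where
    f-equal : f (split p) ≡ f (split q)
    f-equal = trans (sym (split∘join _)) (trans (cong split flat-p≡flat-q) (split∘join _))
  preimage : ∃ λ p → flat p ≡ join y
  preimage = injective⇒surjective flat-injective (join y)
  p : Fin (N * k)
  p = proj₁ preimage
  flat-p≡join-y : flat p ≡ join y
  flat-p≡join-y = proj₂ preimage

invert : ∀ {M} {A : Set} {g : Fin M → A} {enc : A → Fin M} →
  Injective _≡_ _≡_ g → Injective _≡_ _≡_ enc →
  Σ (A → Fin M) λ φ → Bijective _≡_ _≡_ φ × (∀ a → g (φ a) ≡ a)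
invert {M} {A} {g} {enc} g-injective enc-injective = φ , (φ-injective , φ-surjective) , g∘φ
  where
  hit : ∀ a → ∃ λ j → enc (g j) ≡ enc a
  hit a = injective⇒surjective (g-injective ∘ enc-injective) (enc a)
  φ : A → Fin M
  φ a = proj₁ (hit a)
  g∘φ : ∀ a → g (φ a) ≡ a
  g∘φ a = enc-injective (proj₂ (hit a))
  φ-injective : Injective _≡_ _≡_ φ
  φ-injective {a} {b} φa≡φb = trans (sym (g∘φ a)) (trans (cong g φa≡φb) (g∘φ b))
  φ-surjective : ∀ j → ∃ λ a → ∀ {b} → b ≡ a → φ b ≡ j
  φ-surjective j = g j , λ {b} b≡gj → g-injective (trans (g∘φ b) b≡gj)

encode : ∀ {k n} → Vec (Fin k) n → Fin (k ^ n)
encode = funToFin ∘ lookup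

encode-injective : ∀ {k n} → Injective _≡_ _≡_ (encode {k} {n})
encode-injective {x = u} {w} eu≡ew = begin
  u                  ≡⟨ sym (tabulate∘lookup u) ⟩
  tabulate (lookup u) ≡⟨ tabulate-cong same-letters ⟩
  tabulate (lookup w) ≡⟨ tabulate∘lookup w ⟩
  w                  ∎
  where
  open ≡-Reasoning
  same-letters : ∀ i → lookup u i ≡ lookup w i
  same-letters i = begin
    lookup u i              ≡⟨ sym (finToFun-funToFin (lookup u) i) ⟩
    finToFun (encode u) i   ≡⟨ cong (λ c → finToFun c i) eu≡ew ⟩
    finToFun (encode w) i   ≡⟨ finToFun-funToFin (lookup w) i ⟩
    lookup w i              ∎

-- Matchings in a bipartite multigraph whose N left nodes have k slots each.
-- Slot r of node j is an edge to the vertex  slot j r ; the colouring shows that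
-- every vertex carries at most k slots.
module RegularMatching
  {N k : ℕ} (k≥1 : 1 ≤ k) {V : Set} (_≟ᵥ_ : DecidableEquality V)
  (slot : Fin N → Fin k → V) (colour : Fin N → Fin k → Fin k)
  (separated : ∀ {j r j′ r′} → slot j r ≡ slot j′ r′ → colour j r ≡ colour j′ r′ → (j , r) ≡ (j′ , r′))
  where

  nothing≢just : ∀ {r : Fin k} → nothing ≢ just r
  nothing≢just ()

  Matching : Set
  Matching = Fin N → Maybe (Fin k)

  Matched : Matching → Pred (Fin N) 0ℓ
  Matched m x = ∃ λ r → m x ≡ just r

  Partner : Matching → V → Pred (Fin N) 0ℓ
  Partner m v x = ∃ λ r → m x ≡ just r × slot x r ≡ v

  Valid : Matching → Set
  Valid m = ∀ {x y v} → Partner m v x → Partner m v y → x ≡ y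

  Free : Matching → V → Set
  Free m v = ¬ ∃ (Partner m v)

  partner? : ∀ m v → Decidable (Partner m v)
  partner? m v x with m x
  ... | nothing = no λ { (_ , () , _) }
  ... | just r with slot x r ≟ᵥ v
  ...   | yes sx≡v = yes (r , refl , sx≡v)
  ...   | no sx≢v = no λ { (r , refl , sx≡v) → sx≢v sx≡v }

  free? : ∀ m v → Dec (Free m v)
  free? m v = ¬? (any? (partner? m v))

  partner-vertex : ∀ {m x v w} → Partner m v x → Partner m w x → v ≡ w
  partner-vertex {x = x} (ρ , mx≡ρ , sxρ≡v) (ρ′ , mx≡ρ′ , sxρ′≡w) =
    trans (sym sxρ≡v) (trans (cong (slot x) (just-injective (trans (sym mx≡ρ) mx≡ρ′))) sxρ′≡w)

  Augmentation : Matching → Fin N → Set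
  Augmentation m j₀ = Σ Matching λ m′ → Valid m′ × Matched m′ j₀ × Matched m ⊆ Matched m′

  _[_↦_] : Matching → Fin N → Fin k → Matching
  m [ j ↦ r ] = updateAt m j (const (just r))

  assigned : ∀ m j r → (m [ j ↦ r ]) j ≡ just r
  assigned m j r = updateAt-updates j m

  unchanged : ∀ m {j r x} → x ≢ j → (m [ j ↦ r ]) x ≡ m x
  unchanged m {j} {x = x} x≢j = updateAt-minimal x j m x≢j

  still-matched : ∀ {m j r} → Matched m ⊆ Matched (m [ j ↦ r ])
  still-matched {m} {j} {r} {x} (ρ , mx≡ρ) with x ≟ j
  ... | yes refl = r , assigned m j r
  ... | no x≢j = ρ , trans (unchanged m x≢j) mx≡ρ

  partner-before : ∀ {m j r v x} → x ≢ j → Partner m v x → Partner (m [ j ↦ r ]) v x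
  partner-before {m} x≢j (ρ , mx≡ρ , sx) = ρ , trans (unchanged m x≢j) mx≡ρ , sx

  partner-after : ∀ {m j r v x} → Partner (m [ j ↦ r ]) v x →
    (x ≡ j × slot j r ≡ v) ⊎ (x ≢ j × Partner m v x)
  partner-after {m} {j} {r} {x = x} (ρ , m′x≡ρ , sx) with x ≟ j
  ... | yes refl = inj₁ (refl , trans (cong (slot x) (just-injective (trans (sym (assigned m x r)) m′x≡ρ))) sx)
  ... | no x≢j = inj₂ (x≢j , ρ , trans (sym (unchanged m x≢j)) m′x≡ρ , sx)

  valid-rematch : ∀ {m j r} → Valid m → Free m (slot j r) → Valid (m [ j ↦ r ])
  valid-rematch {m} {j} {r} valid free px py with partner-after px | partner-after py
  ... | inj₁ (x≡j , _)  | inj₁ (y≡j , _)  = trans x≡j (sym y≡j)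
  ... | inj₁ (_ , sj≡v) | inj₂ (_ , py′)  = ⊥-elim (free (_ , subst (λ w → Partner m w _) (sym sj≡v) py′))
  ... | inj₂ (_ , px′)  | inj₁ (_ , sj≡v) = ⊥-elim (free (_ , subst (λ w → Partner m w _) (sym sj≡v) px′))
  ... | inj₂ (_ , px′)  | inj₂ (_ , py′)  = valid px′ py′

  augmentation-before : ∀ {m j r j₀} → Augmentation (m [ j ↦ r ]) j₀ → Augmentation m j₀
  augmentation-before (m′ , valid′ , matched-j₀ , keeps) = m′ , valid′ , matched-j₀ , keeps ∘ still-matched

  Reach : Matching → Fin N → ℕ → Pred (Fin N) 0ℓ
  Reach m j₀ zero x = x ≡ j₀
  Reach m j₀ (suc t) x = Reach m j₀ t x ⊎ ∃₂ λ y r → Reach m j₀ t y × Partner m (slot y r) x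

  reach? : ∀ m j₀ t → Decidable (Reach m j₀ t)
  reach? m j₀ zero x = x ≟ j₀
  reach? m j₀ (suc t) x =
    reach? m j₀ t x ⊎-dec any? λ y → any? λ r → reach? m j₀ t y ×-dec partner? m (slot y r) x

  reach-start : ∀ {m j₀} t → Reach m j₀ t j₀
  reach-start zero = refl
  reach-start (suc t) = inj₁ (reach-start t)

  reach-avoiding : ∀ {m j₀ j r} t {x} → Reach m j₀ t x → ¬ Reach m j₀ t j → Reach (m [ j ↦ r ]) j₀ t x
  reach-avoiding zero reach-x _ = reach-x
  reach-avoiding (suc t) (inj₁ reach-x) ¬reach-j = inj₁ (reach-avoiding t reach-x (¬reach-j ∘ inj₁))
  reach-avoiding {j = j} (suc t) {x} (inj₂ step@(y , r , reach-y , px)) ¬reach-j =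
    inj₂ (y , r , reach-avoiding t reach-y (¬reach-j ∘ inj₁) , partner-before x≢j px)
    where
    x≢j : x ≢ j
    x≢j refl = ¬reach-j (inj₂ step)

  -- Along a shortest path, rematch its last node j to the free
  -- vertex; this frees j's old vertex, which the shorter path to j's predecessor
  -- y (untouched, as it avoids j) can take in turn.
  augment-along : ∀ {j₀} t {m j r} → Valid m → m j₀ ≡ nothing →
    Reach m j₀ t j → Free m (slot j r) → Augmentation m j₀
  augment-along zero {m} {r = r} valid _ refl free =
    m [ _ ↦ r ] , valid-rematch valid free , (r , assigned m _ r) , still-matched
  augment-along (suc t) valid unmatched (inj₁ reach-j) free = augment-along t valid unmatched reach-j free
  augment-along {j₀} (suc t) {m} {j} {r} valid unmatched (inj₂ (y , r′ , reach-y , ρ , mj≡ρ , sjρ≡syr′)) free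
    with reach? m j₀ t j
  ... | yes reach-j = augment-along t valid unmatched reach-j free
  ... | no ¬reach-j = augmentation-before
    (augment-along t (valid-rematch valid free) still-unmatched (reach-avoiding t reach-y ¬reach-j) freed)
    where
    still-unmatched : (m [ j ↦ r ]) j₀ ≡ nothing
    still-unmatched = trans (unchanged m j₀≢j) unmatched
      where
      j₀≢j : j₀ ≢ j
      j₀≢j refl = nothing≢just (trans (sym unmatched) mj≡ρ)
    freed : Free (m [ j ↦ r ]) (slot y r′)
    freed (x , px) with partner-after px
    ... | inj₁ (_ , sjr≡syr′) = free (j , ρ , mj≡ρ , trans sjρ≡syr′ (sym sjr≡syr′))
    ... | inj₂ (x≢j , px′) = x≢j (valid px′ (ρ , mj≡ρ , sjρ≡syr′))

  -- Hall's condition for regular graphs: a decidable set R of nodes containing an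
  -- unmatched node j₀ and closed under alternating steps cannot have every slot at
  -- a matched vertex.  Otherwise sending each slot (j , r) of R to
  -- (partner of slot j r , colour j r), and fixing slots outside R, is an injective
  -- endomap of Fin N × Fin k that misses the slots of j₀.
  no-trapped-set : ∀ {m j₀} {R : Pred (Fin N) 0ℓ} → Decidable R → Valid m → m j₀ ≡ nothing → R j₀ →
    (occupied : ∀ j r → R j → ∃ (Partner m (slot j r))) →
    (closed : ∀ {j r x} → R j → Partner m (slot j r) x → R x) → ⊥
  no-trapped-set {m} {j₀} {R} R? valid unmatched R-j₀ occupied closed =
    step-misses (R? _) (proj₂ (injective⇒surjective² F-injective (j₀ , fromℕ< k≥1)))
    where
    step : ∀ j r → Dec (R j) → Fin N × Fin k
    step j r (yes R-j) = proj₁ (occupied j r R-j) , colour j r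
    step j r (no _) = j , r
    F : Fin N × Fin k → Fin N × Fin k
    F (j , r) = step j r (R? j)
    step-injective : ∀ {j r j′ r′} d d′ → step j r d ≡ step j′ r′ d′ → (j , r) ≡ (j′ , r′)
    step-injective {j} {r} {j′} {r′} (yes R-j) (yes R-j′) e =
      separated (partner-vertex {m} p (subst (Partner m (slot j′ r′)) (sym (cong proj₁ e)) p′)) (cong proj₂ e)
      where
      p : Partner m (slot j r) (proj₁ (occupied j r R-j))
      p = proj₂ (occupied j r R-j)
      p′ : Partner m (slot j′ r′) (proj₁ (occupied j′ r′ R-j′))
      p′ = proj₂ (occupied j′ r′ R-j′)
    step-injective {j} {r} (yes R-j) (no ¬R-j′) e =
      ⊥-elim (¬R-j′ (subst R (cong proj₁ e) (closed R-j (proj₂ (occupied j r R-j)))))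
    step-injective {j′ = j′} {r′} (no ¬R-j) (yes R-j′) e =
      ⊥-elim (¬R-j (subst R (sym (cong proj₁ e)) (closed R-j′ (proj₂ (occupied j′ r′ R-j′)))))
    step-injective (no _) (no _) e = e
    F-injective : Injective _≡_ _≡_ F
    F-injective {j , r} {j′ , r′} = step-injective (R? j) (R? j′)
    step-misses : ∀ {j r} d → step j r d ≢ (j₀ , fromℕ< k≥1)
    step-misses {j} {r} (yes R-j) e with occupied j r R-j
    ... | x , ρ , mx≡ρ , _ = nothing≢just (trans (sym unmatched) (subst (λ z → m z ≡ just ρ) (cong proj₁ e) mx≡ρ))
    step-misses (no ¬R-j) e = ¬R-j (subst R (sym (cong proj₁ e)) R-j₀)

  -- Every valid matching can be augmented at an unmatched node: the stationary
  -- alternating reach set is closed, so it contains an augmenting path.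
  augment : ∀ {m j₀} → Valid m → m j₀ ≡ nothing → Augmentation m j₀
  augment {m} {j₀} valid unmatched with stabilises (reach? m j₀) (λ t → inj₁)
  ... | t , stationary with any? (λ j → any? (λ r → reach? m j₀ t j ×-dec free? m (slot j r)))
  ...   | yes (j , r , reach-j , free) = augment-along t valid unmatched reach-j free
  ...   | no none = ⊥-elim (no-trapped-set (reach? m j₀ t) valid unmatched (reach-start t) occupied closed)
    where
    occupied : ∀ j r → Reach m j₀ t j → ∃ (Partner m (slot j r))
    occupied j r reach-j = decidable-stable (any? (partner? m (slot j r))) (λ free → none (j , r , reach-j , free))
    closed : ∀ {j r x} → Reach m j₀ t j → Partner m (slot j r) x → Reach m j₀ t x
    closed reach-j px = stationary (inj₂ (_ , _ , reach-j , px))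

  match-one : ∀ {m} → Valid m → ∀ j → Augmentation m j
  match-one {m} valid j with m j in mj
  ... | just r = m , valid , (r , mj) , id
  ... | nothing = augment valid mj

  match-all : (js : List (Fin N)) → Σ Matching λ m → Valid m × All (Matched m) js
  match-all [] = (λ _ → nothing) , (λ { (_ , () , _) _ }) , []
  match-all (j ∷ js) with m , valid , matched ← match-all js
                     with m′ , valid′ , matched-j , keeps ← match-one valid j
    = m′ , valid′ , matched-j ∷ All.map keeps matched

  saturating-matching : Σ (Fin N → Fin k) λ s → Injective _≡_ _≡_ (λ j → slot j (s j))
  saturating-matching with m , valid , matched ← match-all (allFin N) = s , chosen-injective
    where
    total : ∀ j → Matched m j
    total j = All.lookup matched (∈-allFin j)
    s : Fin N → Fin k
    s j = proj₁ (total j)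
    chosen-injective : Injective _≡_ _≡_ (λ j → slot j (s j))
    chosen-injective {x} {y} sx≡sy = valid (s x , proj₂ (total x) , sx≡sy) (s y , proj₂ (total y) , refl)

-- Slot r of section j
-- is cycle position j k + r; its vertex is the head of the edge there, and its
-- colour is the first letter of that edge.  Since an edge is its first letter
-- followed by its head, colour and vertex determine the position.
module Sections {k n} (e : Fin (numEdges k n) → Edge k n) (e-injective : Injective _≡_ _≡_ e) where

  position : Fin (k ^ n) → Fin k → Fin (numEdges k n)
  position j r = cast (*-comm (k ^ n) k) (combine j r)

  toℕ-position : ∀ j r → toℕ (position j r) ≡ toℕ j * k + toℕ r
  toℕ-position j r = begin
    toℕ (position j r)    ≡⟨ toℕ-cast (*-comm (k ^ n) k) (combine j r) ⟩
    toℕ (combine j r)     ≡⟨ toℕ-combine j r ⟩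
    k * toℕ j + toℕ r     ≡⟨ cong (_+ toℕ r) (*-comm k (toℕ j)) ⟩
    toℕ j * k + toℕ r     ∎
    where open ≡-Reasoning

  member : Fin (k ^ n) → Fin k → Vertex k n
  member j r = head (e (position j r))

  label : Fin (k ^ n) → Fin k → Fin k
  label j r = Vec.head (e (position j r))

  member-occurs : ∀ j r → OccursIn e (member j r) j
  member-occurs j r = r , position j r , toℕ-position j r , refl

  separated : ∀ {j r j′ r′} → member j r ≡ member j′ r′ → label j r ≡ label j′ r′ → (j , r) ≡ (j′ , r′)
  separated {j} {r} {j′} {r′} same-head same-letter =
    cong₂ _,_ (proj₁ same-slot) (proj₂ same-slot)
    where
    letter∷head : ∀ (w : Edge k n) → w ≡ Vec.head w ∷ head w
    letter∷head (a ∷ w) = refl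
    same-position : position j r ≡ position j′ r′
    same-position = e-injective (trans (letter∷head _) (trans (cong₂ _∷_ same-letter same-head) (sym (letter∷head _))))
    same-slot : j ≡ j′ × r ≡ r′
    same-slot = combine-injective j r j′ r′ (toℕ-injective (begin
      toℕ (combine j r)    ≡⟨ sym (toℕ-cast (*-comm (k ^ n) k) (combine j r)) ⟩
      toℕ (position j r)   ≡⟨ cong toℕ same-position ⟩
      toℕ (position j′ r′) ≡⟨ toℕ-cast (*-comm (k ^ n) k) (combine j′ r′) ⟩
      toℕ (combine j′ r′)  ∎))
      where open ≡-Reasoning

-- A saturating matching picks in
-- each section j a member  chosen j , injectively; as there are as many vertices
-- as sections, its inverse is the required bijection φ.
mainTheorem4 : ∀ (k n : ℕ) → k ≥ 1 → n ≥ 1 →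
    (e : Fin (numEdges k n) → Edge k n) → IsPointedEulerian k n e → HasPerfectMatchingD k n e
mainTheorem4 k n k≥1 _ e (_ , e-injective , _) = φ , φ-bijective , occurs
  where
  open Sections e e-injective
  open RegularMatching k≥1 (≡-dec _≟_) member label separated using (saturating-matching)
  s : Fin (k ^ n) → Fin k
  s = proj₁ saturating-matching
  chosen : Fin (k ^ n) → Vertex k n
  chosen j = member j (s j)
  inverse : Σ (Vertex k n → Fin (k ^ n)) λ φ → Bijective _≡_ _≡_ φ × (∀ v → chosen (φ v) ≡ v)
  inverse = invert {g = chosen} (proj₂ saturating-matching) encode-injective
  φ : Vertex k n → Fin (k ^ n)
  φ = proj₁ inverse
  φ-bijective : Bijective _≡_ _≡_ φ
  φ-bijective = proj₁ (proj₂ inverse)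
  occurs : ∀ v → OccursIn e v (φ v)
  occurs v = subst (λ w → OccursIn e w (φ v)) (proj₂ (proj₂ inverse) v) (member-occurs (φ v) (s (φ v)))
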